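{- Let $c:\mathbb{Z}^2\to\{0,\dots,5\}$ be a configuration with the vertical parity property. Then $F(c,H)$ and $F(c,V)$ also have the vertical parity property.
   Context: Cells are $\mathbb{Z}^2$; $H=(1,0)$, $V=(0,1)$. Updates: $F(c,H)(x)=c(x)-2[c(x)\ge4]+[c(x+H)\ge4]+[c(x-H)\ge4]$ and $F(c,V)(x)=c(x)-2[c(x)\ge4]+[c(x+V)\ge4]+[c(x-V)\ge4]$, where $[\cdot]$ is $1$ if the condition holds and $0$ otherwise. A signal of $c$ is a cell $x$ with $c(x)\ge 4$. A configuration $c$ has the vertical parity property if for every pair of signals $x,y$ of $c$ we have $x-y=(a,2b)$ for some $a,b\in\mathbb{Z}$ (i.e. all signals lie in rows of the same parity). -}

module Defs where

open import Data.Integer using (ℤ; +_; _+_; _-_; _*_; _≤_)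
open import Data.Integer.Properties using (_≤?_)
open import Data.Product using (_×_; _,_; ∃₂)
open import Relation.Nullary using (does)
open import Data.Bool using (if_then_else_)
open import Relation.Binary.PropositionalEquality using (_≡_)

Cell : Set
Cell = ℤ × ℤ

_⊕_ : Cell → Cell → Cell
(a , b) ⊕ (c , d) = (a + c , b + d)

_⊖_ : Cell → Cell → Cell
(a , b) ⊖ (c , d) = (a - c , b - d)

H V : Cell
H = (+ 1 , + 0)
V = (+ 0 , + 1)

-- configurations: integer-valued (F may in principle be applied to any c)
Config : Set
Config = Cell → ℤ

[_≥4] : ℤ → ℤ
[ n ≥4] = if does (+ 4 ≤? n) then + 1 else + 0

F : Config → Cell → Config
F c D x = c x - + 2 * [ c x ≥4] + [ c (x ⊕ D) ≥4] + [ c (x ⊖ D) ≥4]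

Signal : Config → Cell → Set
Signal c x = + 4 ≤ c x

VerticalParity : Config → Set
VerticalParity c = ∀ x y → Signal c x → Signal c y →
  ∃₂ λ (a b : ℤ) → x ⊖ y ≡ (a , + 2 * b)

Range05 : Config → Set
Range05 c = ∀ x → + 0 ≤ c x × c x ≤ + 5

-- A cell neither of whose D-neighbours is a signal is not a signal after the D-update: it
-- loses 2 if it was a signal (and values are at most 5), and is unchanged otherwise. Hence
-- every signal x of F(c,D) has a signal of c at x + D or x − D. These two cells lie in rows
-- of the same parity, so the row parities of the signals of F(c,D) are those of the signals
-- of c shifted by D; this works for every direction D.
module Submission where

open import Defs
open import Data.Empty using (⊥; ⊥-elim)
open import Data.Integer using (ℤ; +_; _+_; _-_; _*_; -_; _≤_; +≤+)
open import Data.Integer.Divisibility.Signed using (_∣_; divides; ∣m⇒∣-m; ∣m∣n⇒∣m+n)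
open import Data.Integer.Properties using (_≤?_; ≤-trans; +-monoˡ-≤; +-identityʳ; +-inverseʳ; *-comm)
open import Data.Integer.Tactic.RingSolver using (solve-∀)
open import Data.Nat using (s≤s)
open import Data.Product using (∃; ∃₂; _×_; _,_; proj₁; proj₂)
open import Data.Sum using (_⊎_; inj₁; inj₂)
open import Relation.Nullary using (¬_; Dec; yes; no)
open import Relation.Binary.PropositionalEquality using (_≡_; refl; trans; cong; subst)

infix 4 _≡₂_

-- A record rather than a synonym for the divisibility, so that m and n stay inferable.
record _≡₂_ (m n : ℤ) : Set where
  constructor mod2
  field 2∣m-n : + 2 ∣ m - n

≡₂-refl : ∀ m → m ≡₂ m
≡₂-refl m = mod2 (divides (+ 0) (+-inverseʳ m))

≡₂-sym : ∀ {m n} → m ≡₂ n → n ≡₂ m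
≡₂-sym {m} {n} (mod2 2∣m-n) = mod2 (subst (+ 2 ∣_) (neg-diff m n) (∣m⇒∣-m 2∣m-n))
  where
  neg-diff : ∀ m n → - (m - n) ≡ n - m
  neg-diff = solve-∀

≡₂-trans : ∀ {m n k} → m ≡₂ n → n ≡₂ k → m ≡₂ k
≡₂-trans {m} {n} {k} (mod2 2∣m-n) (mod2 2∣n-k) =
  mod2 (subst (+ 2 ∣_) (telescope m n k) (∣m∣n⇒∣m+n 2∣m-n 2∣n-k))
  where
  telescope : ∀ m n k → (m - n) + (n - k) ≡ m - k
  telescope = solve-∀

+-cancelʳ-≡₂ : ∀ {m n} d → m + d ≡₂ n + d → m ≡₂ n
+-cancelʳ-≡₂ {m} {n} d (mod2 2∣diff) = mod2 (subst (+ 2 ∣_) (diff-shift m n d) 2∣diff)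
  where
  diff-shift : ∀ m n d → (m + d) - (n + d) ≡ m - n
  diff-shift = solve-∀

m+d≡₂m-d : ∀ m d → m + d ≡₂ m - d
m+d≡₂m-d m d = mod2 (divides d (double m d))
  where
  double : ∀ m d → (m + d) - (m - d) ≡ d * + 2
  double = solve-∀

⊖-even-row⇒≡₂ : ∀ x y {a b} → x ⊖ y ≡ (a , + 2 * b) → proj₂ x ≡₂ proj₂ y
⊖-even-row⇒≡₂ _ _ {b = b} eq = mod2 (divides b (trans (cong proj₂ eq) (*-comm (+ 2) b)))

≡₂⇒⊖-even-row : ∀ x y → proj₂ x ≡₂ proj₂ y → ∃₂ λ a b → x ⊖ y ≡ (a , + 2 * b)
≡₂⇒⊖-even-row x y (mod2 (divides q eq)) =
  proj₁ x - proj₁ y , q , cong (_ ,_) (trans eq (*-comm q (+ 2)))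

[≥4]-signal : ∀ {n} → + 4 ≤ n → [ n ≥4] ≡ + 1
[≥4]-signal {n} 4≤n with + 4 ≤? n
... | yes _ = refl
... | no 4≰n = ⊥-elim (4≰n 4≤n)

[≥4]-non-signal : ∀ {n} → ¬ (+ 4 ≤ n) → [ n ≥4] ≡ + 0
[≥4]-non-signal {n} 4≰n with + 4 ≤? n
... | yes 4≤n = ⊥-elim (4≰n 4≤n)
... | no _ = refl

isolated⇒¬Signal-F : ∀ c D x → c x ≤ + 5 → ¬ Signal c (x ⊕ D) → ¬ Signal c (x ⊖ D) →
  ¬ Signal (F c D) x
isolated⇒¬Signal-F c D x cx≤5 ¬s⁺ ¬s⁻ s = by-cases (+ 4 ≤? c x)
  where
  F-isolated : F c D x ≡ c x - + 2 * [ c x ≥4]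
  F-isolated rewrite [≥4]-non-signal ¬s⁺ | [≥4]-non-signal ¬s⁻ =
    trans (+-identityʳ _) (+-identityʳ _)

  F-after : ∀ {b} → [ c x ≥4] ≡ b → F c D x ≡ c x - + 2 * b
  F-after eq = trans F-isolated (cong (λ b → c x - + 2 * b) eq)

  4≰3 : ¬ (+ 4 ≤ + 3)
  4≰3 (+≤+ (s≤s (s≤s (s≤s ()))))

  by-cases : Dec (+ 4 ≤ c x) → ⊥
  by-cases (yes 4≤cx) =
    4≰3 (≤-trans (subst (+ 4 ≤_) (F-after ([≥4]-signal 4≤cx)) s) (+-monoˡ-≤ (- + 2) cx≤5))
  by-cases (no 4≰cx) =
    4≰cx (subst (+ 4 ≤_) (trans (F-after ([≥4]-non-signal 4≰cx)) (+-identityʳ (c x))) s)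

Signal-F⇒Signal-neighbour : ∀ c D x → c x ≤ + 5 → Signal (F c D) x →
  Signal c (x ⊕ D) ⊎ Signal c (x ⊖ D)
Signal-F⇒Signal-neighbour c D x cx≤5 s = by-cases (+ 4 ≤? c (x ⊕ D)) (+ 4 ≤? c (x ⊖ D))
  where
  by-cases : Dec (Signal c (x ⊕ D)) → Dec (Signal c (x ⊖ D)) →
    Signal c (x ⊕ D) ⊎ Signal c (x ⊖ D)
  by-cases (yes s⁺) _ = inj₁ s⁺
  by-cases (no _) (yes s⁻) = inj₂ s⁻
  by-cases (no ¬s⁺) (no ¬s⁻) = ⊥-elim (isolated⇒¬Signal-F c D x cx≤5 ¬s⁺ ¬s⁻ s)

Signal-F⇒Signal-in-row-parity : ∀ c D x → c x ≤ + 5 → Signal (F c D) x →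
  ∃ λ z → Signal c z × proj₂ (x ⊕ D) ≡₂ proj₂ z
Signal-F⇒Signal-in-row-parity c D x cx≤5 s with Signal-F⇒Signal-neighbour c D x cx≤5 s
... | inj₁ s⁺ = x ⊕ D , s⁺ , ≡₂-refl _
... | inj₂ s⁻ = x ⊖ D , s⁻ , m+d≡₂m-d (proj₂ x) (proj₂ D)

F-preserves-VerticalParity : ∀ c D → (∀ x → c x ≤ + 5) → VerticalParity c → VerticalParity (F c D)
F-preserves-VerticalParity c D c≤5 vp x y sx sy
  with Signal-F⇒Signal-in-row-parity c D x (c≤5 x) sx
     | Signal-F⇒Signal-in-row-parity c D y (c≤5 y) sy
... | zx , szx , x≡₂zx | zy , szy , y≡₂zy with vp zx zy szx szy
... | _ , _ , zx⊖zy≡ = ≡₂⇒⊖-even-row x y (+-cancelʳ-≡₂ (proj₂ D)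
  (≡₂-trans x≡₂zx (≡₂-trans (⊖-even-row⇒≡₂ zx zy zx⊖zy≡) (≡₂-sym y≡₂zy))))

lemma6 : (c : Config) → Range05 c → VerticalParity c →
    VerticalParity (F c H) × VerticalParity (F c V)
lemma6 c range vp = F-preserves-VerticalParity c H c≤5 vp , F-preserves-VerticalParity c V c≤5 vp
  where
  c≤5 : ∀ x → c x ≤ + 5
  c≤5 x = proj₂ (range x)
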